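{- Every st-graph $G$ having a (transitive) congruence partition $C_P$ whose dimensional neck is equal to $2$ has a $2$-dimensional dominance drawing.
   Context: An st-graph is a directed acyclic graph with exactly one source and exactly one sink. Vertex $v$ is reachable from $u$ if there is a directed path (possibly of length zero). The width of a DAG is the maximum size of a set of pairwise incomparable vertices. Let $G^*$ be the transitive closure of $G=(V,E)$. A transitive module is a nonempty $M\subseteq V$ whose vertices all have the same predecessors and the same successors in $V\setminus M$ in $G^*$. A congruence partition $C_P=\{M_1,\dots,M_h\}$ is a partition of $V$ into transitive modules. The quotient graph $G_0$ is obtained from $G$ by merging the vertices of each $M_i$ into one vertex. For $1\le i\le h$, the module-induced graph $G_i$ is the subgraph induced by $M_i$, augmented when necessary with a virtual source (edges to all of $M_i$) and/or virtual sink (edges from all of $M_i$) so that it is an st-graph. The dimensional neck of $C_P$ is the maximum width among $G_0,G_1,\dots,G_h$. A $2$-dimensional dominance drawing assigns each vertex $v$ a point $(X(v),Y(v))$ with $v$ reachable from $u$ iff $X(u)\le X(v)$ and $Y(u)\le Y(v)$. -}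

module Defs where

open import Data.Nat using (ℕ; _≤_)
open import Data.Fin using (Fin)
open import Data.Bool using (Bool; T)
open import Data.List using (List; length)
open import Data.List.Relation.Unary.AllPairs using (AllPairs)
open import Data.Product using (Σ; ∃; _×_; _,_; proj₁)
open import Data.Sum using (_⊎_; inj₁; inj₂)
open import Data.Empty using (⊥)
open import Data.Unit using (⊤)
open import Data.Irrelevant using (Irrelevant)
open import Relation.Nullary using (¬_)
open import Relation.Binary.PropositionalEquality using (_≡_)
open import Relation.Binary.Construct.Closure.ReflexiveTransitive using (Star)
open import Relation.Binary.Construct.Closure.Transitive using (TransClosure)

Rel₀ : Set → Set₁
Rel₀ V = V → V → Set

Reach : {V : Set} → Rel₀ V → Rel₀ V
Reach E = Star E

ReachPlus : {V : Set} → Rel₀ V → Rel₀ V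
ReachPlus E = TransClosure E

Acyclic : {V : Set} → Rel₀ V → Set
Acyclic E = ∀ v → ¬ ReachPlus E v v

IsSource : {V : Set} → Rel₀ V → V → Set
IsSource E v = ∀ u → ¬ E u v

IsSink : {V : Set} → Rel₀ V → V → Set
IsSink E v = ∀ w → ¬ E v w

HasUniqueSource : {V : Set} → Rel₀ V → Set
HasUniqueSource E = Σ _ λ s → IsSource E s × (∀ v → IsSource E v → v ≡ s)

HasUniqueSink : {V : Set} → Rel₀ V → Set
HasUniqueSink E = Σ _ λ t → IsSink E t × (∀ v → IsSink E v → v ≡ t)

IsSTGraph : {V : Set} → Rel₀ V → Set
IsSTGraph E = Acyclic E × HasUniqueSource E × HasUniqueSink E

Incomparable : {V : Set} → Rel₀ V → V → V → Set
Incomparable E u v = ¬ Reach E u v × ¬ Reach E v u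

-- a list of pairwise incomparable vertices (automatically duplicate-free,
-- since reachability is reflexive)
IsAntichain : {V : Set} → Rel₀ V → List V → Set
IsAntichain E xs = AllPairs (Incomparable E) xs

HasWidth : {V : Set} → Rel₀ V → ℕ → Set
HasWidth E k =
  (Σ (List _) λ xs → IsAntichain E xs × length xs ≡ k) ×
  (∀ xs → IsAntichain E xs → length xs ≤ k)

Adj : ℕ → Set
Adj n = Fin n → Fin n → Bool

Edge : {n : ℕ} → Adj n → Rel₀ (Fin n)
Edge A u v = T (A u v)

IsTransitiveModule : {n : ℕ} → Adj n → (Fin n → Set) → Set
IsTransitiveModule A M =
  (Σ (Fin _) M) ×
  (∀ x y w → M x → M y → ¬ M w →
     ((ReachPlus (Edge A) w x → ReachPlus (Edge A) w y) ×
      (ReachPlus (Edge A) w y → ReachPlus (Edge A) w x)) ×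
     ((ReachPlus (Edge A) x w → ReachPlus (Edge A) y w) ×
      (ReachPlus (Edge A) y w → ReachPlus (Edge A) x w)))

-- a congruence partition C_P = {M_1,…,M_h}, represented by the map sending
-- each vertex to (the index of) its class; classes M_i = part ⁻¹(i)
Module : {n h : ℕ} → (Fin n → Fin h) → Fin h → Fin n → Set
Module part i v = part v ≡ i

IsCongruencePartition : {n h : ℕ} → Adj n → (Fin n → Fin h) → Set
IsCongruencePartition A part =
  ∀ i → IsTransitiveModule A (Module part i)

QuotientEdge : {n h : ℕ} → Adj n → (Fin n → Fin h) → Rel₀ (Fin h)
QuotientEdge A part i j =
  Σ (Fin _) λ u → Σ (Fin _) λ v → Edge A u v × part u ≡ i × part v ≡ j

ModVertex : {n h : ℕ} → (Fin n → Fin h) → Fin h → Set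
ModVertex {n} part i = Σ (Fin n) (Module part i)

InducedEdge : {n h : ℕ} → Adj n → (part : Fin n → Fin h) → (i : Fin h) →
              Rel₀ (ModVertex part i)
InducedEdge A part i a b = Edge A (proj₁ a) (proj₁ b)

-- vertices of the module-induced graph G_i: the vertices of M_i, plus a
-- virtual source exactly when the induced subgraph does not have a unique
-- source, plus a virtual sink exactly when it does not have a unique sink.
-- (Irrelevant makes the virtual vertex, when present, a single vertex.)
GiVertex : {n h : ℕ} → Adj n → (Fin n → Fin h) → Fin h → Set
GiVertex A part i =
  ModVertex part i ⊎
  (Irrelevant (¬ HasUniqueSource (InducedEdge A part i)) ⊎
   Irrelevant (¬ HasUniqueSink (InducedEdge A part i)))

GiEdge : {n h : ℕ} → (A : Adj n) → (part : Fin n → Fin h) → (i : Fin h) →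
         Rel₀ (GiVertex A part i)
GiEdge A part i (inj₁ a)        (inj₁ b)        = InducedEdge A part i a b
GiEdge A part i (inj₂ (inj₁ _)) (inj₁ _)        = ⊤
GiEdge A part i (inj₁ _)        (inj₂ (inj₂ _)) = ⊤
GiEdge A part i _               _               = ⊥

DimensionalNeck : {n h : ℕ} → Adj n → (Fin n → Fin h) → ℕ → Set
DimensionalNeck {n} {h} A part k =
  Σ ℕ λ w₀ → Σ (Fin h → ℕ) λ w →
    HasWidth (QuotientEdge A part) w₀ ×
    (∀ i → HasWidth (GiEdge A part i) (w i)) ×
    (w₀ ≤ k × (∀ i → w i ≤ k)) ×
    (w₀ ≡ k ⊎ Σ (Fin h) λ i → w i ≡ k)

IsDominanceDrawing2 : {n : ℕ} → Adj n → (Fin n → ℕ) → (Fin n → ℕ) → Set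
IsDominanceDrawing2 A X Y =
  ∀ u v → (Reach (Edge A) u v → (X u ≤ X v × Y u ≤ Y v)) ×
          ((X u ≤ X v × Y u ≤ Y v) → Reach (Edge A) u v)

-- Write ↝ for reachability.  Width at most 2 makes the incomparability graphs of the quotient and
-- of every module bipartite: inserting vertices from the top down, the vertices incomparable to a
-- new maximal vertex x form a chain, which gets one colour and x the other.  Given such colourings
-- c₀ of the modules and c inside the modules, order each incomparable pair u ∥ v by the
-- lexicographic order of the keys (c₀(module of u), c(u)).  Reachability between different
-- modules depends only on the modules, and this makes ↝ together with that order a total
-- preorder, i.e. a linear extension of ↝.  The reversed keys give a second one whose
-- intersection with the first is ↝, and the ranks in the two extensions are the coordinates.

module Submission where

open import Level using (0ℓ)
open import Data.Nat using (ℕ; _≤_; _<_; s≤s)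
open import Data.Nat.Properties using (≤-trans; <⇒≱; ≤-decTotalOrder)
open import Data.Fin using (Fin; _≟_)
open import Data.Fin.Subset using (Subset; _∈_; _∉_; _⊆_; _⊃_; _∪_; ⁅_⁆; ∣_∣)
open import Data.Fin.Subset.Properties
  using (_∈?_; p⊆q⇒∣p∣≤∣q∣; p⊂q⇒∣p∣<∣q∣; p⊆p∪q; x∈p∪q⁺; x∈p∪q⁻; x∈⁅x⁆; x∈⁅y⁆⇒x≡y)
open import Data.Fin.Subset.Induction using (Acc; acc; ⊃-wellFounded)
open import Data.Fin.Properties using (any?)
open import Data.List using (List; []; _∷_; filter; allFin)
open import Data.List.Membership.Propositional using () renaming (_∈_ to _∈ₗ_)
open import Data.List.Membership.Propositional.Properties using (∈-filter⁺; ∈-filter⁻; ∈-allFin)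
import Data.List.Membership.DecPropositional as DecMembership
open import Data.List.Relation.Unary.Any as Any using (here; there)
import Data.List.Relation.Unary.All as All
open import Data.List.Relation.Unary.AllPairs as AllPairs using (AllPairs; []; _∷_)
open import Data.List.Relation.Unary.AllPairs.Properties using (filter⁺)
open import Data.List.Relation.Unary.Sorted.TotalOrder.Properties using (Sorted⇒AllPairs)
open import Data.List.Relation.Binary.Permutation.Propositional using (↭-sym)
open import Data.List.Relation.Binary.Permutation.Propositional.Properties using (∈-resp-↭)
import Data.List.Sort as Sort
open import Data.Vec using (tabulate)
open import Data.Vec.Properties using (lookup∘tabulate; lookup⇒[]=; []=⇒lookup)
open import Data.Bool using (Bool; true; false; not; if_then_else_; f<t) renaming (_<_ to _<ᵇ_)
import Data.Bool as Bool
open import Data.Bool.Properties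
  using (not-involutive; not-injective; ¬-not; not-¬; <-irrefl; <-asym; <-trans; <-cmp; _<?_)
open import Data.Empty using (⊥; ⊥-elim)
open import Data.Unit using (⊤; tt)
open import Data.List.Relation.Unary.All using ([]; _∷_)
import Data.Product as Product
open import Data.Product.Relation.Binary.Pointwise.NonDependent using (Pointwise)
open import Data.Product.Relation.Binary.Lex.Strict
  using (×-Lex; ×-transitive; ×-asymmetric; ×-compare; ×-decidable)
open import Data.Product using (Σ; ∃; ∃₂; _×_; _,_; _,′_; proj₁; proj₂)
import Data.Sum as Sum
open import Data.Sum using (_⊎_; inj₁; inj₂)
open import Function using (_∘_; id; flip; case_of_)
open import Relation.Nullary using (¬_; Dec; yes; no; does; contradiction)
open import Relation.Nullary.Decidable using (T?; dec-true; dec-false; map′; _×-dec_; _⊎-dec_; ¬?)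
open import Relation.Unary as U using (Pred)
open import Relation.Binary.Bundles using (DecTotalOrder)
import Relation.Binary.Construct.On as On
open import Relation.Binary.Definitions
  using (Decidable; Reflexive; Transitive; Total; Asymmetric; Trichotomous; tri<; tri≈; tri>)
open import Relation.Binary.PropositionalEquality
  using (_≡_; _≢_; refl; sym; trans; subst; cong; isEquivalence; resp₂)
open import Relation.Binary.Construct.Closure.ReflexiveTransitive using (Star; ε; _◅_; _◅◅_)
open import Relation.Binary.Construct.Closure.Transitive using (TransClosure; [_]; _∷_)

open import Defs

module _ {n : ℕ} {P : Pred (Fin n) 0ℓ} (P? : U.Decidable P) where

  satisfying : Subset n
  satisfying = tabulate (does ∘ P?)

  count : ℕ
  count = ∣ satisfying ∣

  ∈-satisfying⁺ : ∀ {v} → P v → v ∈ satisfying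
  ∈-satisfying⁺ {v} pv = lookup⇒[]= v _ (trans (lookup∘tabulate (does ∘ P?) v) (dec-true (P? v) pv))

  ∈-satisfying⁻ : ∀ {v} → v ∈ satisfying → P v
  ∈-satisfying⁻ {v} v∈ with P? v | trans (sym (lookup∘tabulate (does ∘ P?) v)) ([]=⇒lookup v∈)
  ... | yes pv | _ = pv
  ... | no _   | ()

module _ {n : ℕ} {P Q : Pred (Fin n) 0ℓ} (P? : U.Decidable P) (Q? : U.Decidable Q)
         (P⊆Q : ∀ {v} → P v → Q v) where

  count-mono : count P? ≤ count Q?
  count-mono = p⊆q⇒∣p∣≤∣q∣ (∈-satisfying⁺ Q? ∘ P⊆Q ∘ ∈-satisfying⁻ P?)

  count-strict : ∀ {w} → Q w → ¬ P w → count P? < count Q?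
  count-strict {w} qw ¬pw =
    p⊂q⇒∣p∣<∣q∣ (∈-satisfying⁺ Q? ∘ P⊆Q ∘ ∈-satisfying⁻ P? ,
                 w , ∈-satisfying⁺ Q? qw , ¬pw ∘ ∈-satisfying⁻ P?)

module Rank {n : ℕ} {_⊑_ : Rel₀ (Fin n)} (⊑? : Decidable _⊑_)
            (⊑-refl : Reflexive _⊑_) (⊑-trans : Transitive _⊑_) (⊑-total : Total _⊑_) where

  rank : Fin n → ℕ
  rank v = count (flip ⊑? v)

  rank-mono : ∀ {u v} → u ⊑ v → rank u ≤ rank v
  rank-mono {u} {v} u⊑v = count-mono (flip ⊑? u) (flip ⊑? v) (λ w⊑u → ⊑-trans w⊑u u⊑v)

  rank-reflects : ∀ {u v} → rank u ≤ rank v → u ⊑ v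
  rank-reflects {u} {v} ru≤rv with ⊑? u v | ⊑-total u v
  ... | yes u⊑v | _        = u⊑v
  ... | no u⋢v  | inj₁ u⊑v = contradiction u⊑v u⋢v
  ... | no u⋢v  | inj₂ v⊑u =
    contradiction ru≤rv
      (<⇒≱ (count-strict (flip ⊑? v) (flip ⊑? u) (λ w⊑v → ⊑-trans w⊑v v⊑u) ⊑-refl u⋢v))

module Reachability {n : ℕ} {_⟶_ : Rel₀ (Fin n)} (⟶? : Decidable _⟶_) where

  Closed : Subset n → Set
  Closed S = ∀ {x y} → x ∈ S → x ⟶ y → y ∈ S

  star-closed : ∀ {S x y} → Closed S → x ∈ S → Star _⟶_ x y → y ∈ S
  star-closed S-closed x∈S ε           = x∈S
  star-closed S-closed x∈S (x⟶z ◅ z↝y) = star-closed S-closed (S-closed x∈S x⟶z) z↝y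

  Exit : Subset n → Set
  Exit S = ∃₂ λ x y → x ∈ S × x ⟶ y × y ∉ S

  exit? : ∀ S → Dec (Exit S)
  exit? S = any? λ x → any? λ y → x ∈? S ×-dec ⟶? x y ×-dec ¬? (y ∈? S)

  no-exit⇒closed : ∀ {S} → ¬ Exit S → Closed S
  no-exit⇒closed {S} ¬exit {x} {y} x∈S x⟶y with y ∈? S
  ... | yes y∈S = y∈S
  ... | no y∉S  = contradiction (x , y , x∈S , x⟶y , y∉S) ¬exit

  Reachable : Fin n → Subset n → Set
  Reachable u S = ∀ {y} → y ∈ S → Star _⟶_ u y

  reachable-∪-step : ∀ {u S x y} → Reachable u S → x ∈ S → x ⟶ y → Reachable u (S ∪ ⁅ y ⁆)
  reachable-∪-step {S = S} {y = y} S-reachable x∈S x⟶y z∈ with x∈p∪q⁻ S _ z∈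
  ... | inj₁ z∈S = S-reachable z∈S
  ... | inj₂ z∈y rewrite x∈⁅y⁆⇒x≡y y z∈y = S-reachable x∈S ◅◅ (x⟶y ◅ ε)

  closure : ∀ u S → Acc _⊃_ S → Reachable u S → ∃ λ T → S ⊆ T × Reachable u T × Closed T
  closure u S (acc larger) S-reachable with exit? S
  ... | no ¬exit = S , id , S-reachable , no-exit⇒closed ¬exit
  ... | yes (x , y , x∈S , x⟶y , y∉S)
    with T , S∪y⊆T , T-reachable , T-closed ←
           closure u (S ∪ ⁅ y ⁆) (larger (p⊆p∪q _ , y , x∈p∪q⁺ (inj₂ (x∈⁅x⁆ y)) , y∉S))
                   (reachable-∪-step S-reachable x∈S x⟶y)
    = T , S∪y⊆T ∘ p⊆p∪q _ , T-reachable , T-closed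

  Star? : Decidable (Star _⟶_)
  Star? u v with closure u ⁅ u ⁆ (⊃-wellFounded _)
                         (λ y∈ → subst (Star _⟶_ u) (sym (x∈⁅y⁆⇒x≡y u y∈)) ε)
  ... | T , ⁅u⁆⊆T , T-reachable , T-closed =
    map′ T-reachable (star-closed T-closed (⁅u⁆⊆T (x∈⁅x⁆ u))) (v ∈? T)

module Incomparability {m : ℕ} {_≼_ : Rel₀ (Fin m)} (≼? : Decidable _≼_)
                       (≼-refl : Reflexive _≼_) (≼-trans : Transitive _≼_) where

  infix 4 _∥_
  _∥_ : Rel₀ (Fin m)
  a ∥ b = ¬ a ≼ b × ¬ b ≼ a

  ∥? : Decidable _∥_
  ∥? a b = ¬? (≼? a b) ×-dec ¬? (≼? b a)

  ∥-sym : ∀ {a b} → a ∥ b → b ∥ a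
  ∥-sym (a⋠b , b⋠a) = b⋠a , a⋠b

  ∥-irrefl : ∀ {a} → ¬ a ∥ a
  ∥-irrefl (a⋠a , _) = a⋠a ≼-refl

  compare : ∀ a b → a ≼ b ⊎ b ≼ a ⊎ a ∥ b
  compare a b with ≼? a b | ≼? b a
  ... | yes a≼b | _       = inj₁ a≼b
  ... | no _    | yes b≼a = inj₂ (inj₁ b≼a)
  ... | no a⋠b  | no b⋠a  = inj₂ (inj₂ (a⋠b , b⋠a))

  Width≤2 : Pred (Fin m) 0ℓ → Set
  Width≤2 S = ∀ {a b c} → S a → S b → S c → a ∥ b → a ∥ c → b ∥ c → ⊥

  ChainColouring : Pred (Fin m) 0ℓ → (Fin m → Bool) → Set
  ChainColouring S colour = ∀ {a b} → S a → S b → a ∥ b → colour a ≢ colour b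

  chains-⊆ : ∀ {S S′ colour} → (∀ {a} → S′ a → S a) →
             ChainColouring S colour → ChainColouring S′ colour
  chains-⊆ S′⊆S chains s′a s′b = chains (S′⊆S s′a) (S′⊆S s′b)

  module Insertion {P : Pred (Fin m) 0ℓ} (P? : U.Decidable P) {x : Fin m}
                   (x-maximal : ∀ {b} → P b → x ≼ b → b ≼ x)
                   (beside-x-comparable : ∀ {a b} → P a → P b → a ∥ x → b ∥ x → ¬ a ∥ b)
                   {colour : Fin m → Bool} (chains : ChainColouring P colour) where

    P⁺ : Pred (Fin m) 0ℓ
    P⁺ v = v ≡ x ⊎ P v

    P⁺-≢ : ∀ {v} → P⁺ v → v ≢ x → P v
    P⁺-≢ (inj₁ v≡x) v≢x = contradiction v≡x v≢x
    P⁺-≢ (inj₂ pv)  _   = pv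

    P⁺-∥ : ∀ {v} → P⁺ v → v ∥ x → P v
    P⁺-∥ pv v∥x = P⁺-≢ pv λ { refl → ∥-irrefl v∥x }

    below-x : ∀ {b} → P b → ¬ b ∥ x → b ≼ x
    below-x {b} pb ¬b∥x with compare b x
    ... | inj₁ b≼x        = b≼x
    ... | inj₂ (inj₁ x≼b) = x-maximal pb x≼b
    ... | inj₂ (inj₂ b∥x) = contradiction b∥x ¬b∥x

    -- Colour k cannot go to the elements incomparable to x: b ≼ x keeps it, and a ∥ b.
    Blocked : Bool → Set
    Blocked k = ∃₂ λ a b → P a × a ∥ x × P b × b ≼ x × a ∥ b × colour b ≡ k

    blocked? : ∀ k → Dec (Blocked k)
    blocked? k = any? λ a → any? λ b →
      P? a ×-dec ∥? a x ×-dec P? b ×-dec ≼? b x ×-dec ∥? a b ×-dec (colour b Bool.≟ k)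

    crossing : ∀ {a a′ b} → P a → a ∥ x → P b → b ≼ x → a′ ∥ b → a ≼ a′ → colour a ≡ colour b → ⊥
    crossing {a} {b = b} pa a∥x pb b≼x a′∥b a≼a′ same with compare a b
    ... | inj₁ a≼b        = proj₁ a∥x (≼-trans a≼b b≼x)
    ... | inj₂ (inj₁ b≼a) = proj₂ a′∥b (≼-trans b≼a a≼a′)
    ... | inj₂ (inj₂ a∥b) = chains pa pb a∥b same

    colour-opposite : ∀ {c d l} → P c → P d → c ∥ d → colour d ≡ l → colour c ≡ not l
    colour-opposite pc pd c∥d refl = ¬-not (chains pc pd c∥d)

    not-blocked-both : ∀ k → Blocked k → ¬ Blocked (not k)
    not-blocked-both k (a , b , pa , a∥x , pb , b≼x , a∥b , cb≡k)
                       (a′ , b′ , pa′ , a′∥x , pb′ , b′≼x , a′∥b′ , cb′≡¬k) with compare a a′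
    ... | inj₁ a≼a′ =
      crossing pa a∥x pb′ b′≼x a′∥b′ a≼a′ (trans (colour-opposite pa pb a∥b cb≡k) (sym cb′≡¬k))
    ... | inj₂ (inj₁ a′≼a) =
      crossing pa′ a′∥x pb b≼x a∥b a′≼a
        (trans (colour-opposite pa′ pb′ a′∥b′ cb′≡¬k) (trans (not-involutive k) (sym cb≡k)))
    ... | inj₂ (inj₂ a∥a′) = beside-x-comparable pa pa′ a∥x a′∥x a∥a′

    recolour : Bool → Fin m → Bool
    recolour k v = if does (∥? v x) then k else if does (v ≟ x) then not k else colour v

    recolour-∥ : ∀ {k v} → v ∥ x → recolour k v ≡ k
    recolour-∥ {v = v} v∥x rewrite dec-true (∥? v x) v∥x = refl

    recolour-x : ∀ {k} → recolour k x ≡ not k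
    recolour-x rewrite dec-false (∥? x x) ∥-irrefl | dec-true (x ≟ x) refl = refl

    recolour-≡x : ∀ {k v} → v ≡ x → recolour k v ≡ not k
    recolour-≡x refl = recolour-x

    recolour-other : ∀ {k v} → ¬ v ∥ x → v ≢ x → recolour k v ≡ colour v
    recolour-other {v = v} ¬v∥x v≢x rewrite dec-false (∥? v x) ¬v∥x | dec-false (v ≟ x) v≢x = refl

    one-beside : ∀ {k u v} → ¬ Blocked k → P⁺ u → P⁺ v → u ∥ x → ¬ v ∥ x → u ∥ v →
                 recolour k u ≢ recolour k v
    one-beside {k} {u} {v} ¬blocked pu pv u∥x ¬v∥x u∥v same = case v ≟ x of λ where
      (yes v≡x) → not-¬ refl (trans (sym (recolour-∥ u∥x)) (trans same (recolour-≡x v≡x)))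
      (no v≢x)  → ¬blocked (u , v , P⁺-∥ pu u∥x , u∥x , P⁺-≢ pv v≢x , below-x (P⁺-≢ pv v≢x) ¬v∥x , u∥v ,
                            trans (sym (recolour-other ¬v∥x v≢x)) (trans (sym same) (recolour-∥ u∥x)))

    neither-beside : ∀ {k u v} → P⁺ u → P⁺ v → ¬ u ∥ x → ¬ v ∥ x → u ∥ v →
                     recolour k u ≢ recolour k v
    neither-beside {u = u} {v} pu pv ¬u∥x ¬v∥x u∥v same = case ((u ≟ x) ,′ (v ≟ x)) of λ where
      (yes refl , _)       → ¬v∥x (∥-sym u∥v)
      (no _ , yes refl)    → ¬u∥x u∥v
      (no u≢x , no v≢x)    → chains (P⁺-≢ pu u≢x) (P⁺-≢ pv v≢x) u∥v
        (trans (sym (recolour-other ¬u∥x u≢x)) (trans same (recolour-other ¬v∥x v≢x)))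

    recolour-chains : ∀ {k} → ¬ Blocked k → ChainColouring P⁺ (recolour k)
    recolour-chains ¬blocked {u} {v} pu pv u∥v same = case (∥? u x ,′ ∥? v x) of λ where
      (yes u∥x , yes v∥x) → beside-x-comparable (P⁺-∥ pu u∥x) (P⁺-∥ pv v∥x) u∥x v∥x u∥v
      (yes u∥x , no ¬v∥x) → one-beside ¬blocked pu pv u∥x ¬v∥x u∥v same
      (no ¬u∥x , yes v∥x) → one-beside ¬blocked pv pu v∥x ¬u∥x (∥-sym u∥v) (sym same)
      (no ¬u∥x , no ¬v∥x) → neither-beside pu pv ¬u∥x ¬v∥x u∥v same

    insert : ∃ (ChainColouring P⁺)
    insert with blocked? true
    ... | yes blocked = recolour false , recolour-chains (not-blocked-both true blocked)
    ... | no ¬blocked = recolour true , recolour-chains ¬blocked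

  open DecMembership (_≟_ {m}) using () renaming (_∈?_ to _∈ₗ?_)

  NotStrictlyBelow : Rel₀ (Fin m)
  NotStrictlyBelow a b = a ≼ b → b ≼ a

  colour-list : ∀ xs → AllPairs NotStrictlyBelow xs → Width≤2 (_∈ₗ xs) →
                ∃ (ChainColouring (_∈ₗ xs))
  colour-list []       _                       _     = (λ _ → true) , λ ()
  colour-list (x ∷ xs) (x-maximal ∷ xs-sorted) width
    with colour , chains ← colour-list xs xs-sorted
                             (λ pa pb pc → width (there pa) (there pb) (there pc))
    = Product.map₂ (chains-⊆ Any.toSum)
                   (Insertion.insert (_∈ₗ? xs) (All.lookup x-maximal) beside chains)
    where
    beside : ∀ {a b} → a ∈ₗ xs → b ∈ₗ xs → a ∥ x → b ∥ x → ¬ a ∥ b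
    beside pa pb a∥x b∥x a∥b = width (there pa) (there pb) (here refl) a∥b a∥x b∥x

  upSize : Fin m → ℕ
  upSize a = count (≼? a)

  upSize-≤⇒not-strictly-below : ∀ {a b} → upSize a ≤ upSize b → NotStrictlyBelow a b
  upSize-≤⇒not-strictly-below {a} {b} up≤ a≼b with ≼? b a
  ... | yes b≼a = b≼a
  ... | no b⋠a  = contradiction up≤ (<⇒≱ (count-strict (≼? b) (≼? a) (≼-trans a≼b) ≼-refl b⋠a))

  by-upSize : DecTotalOrder 0ℓ 0ℓ 0ℓ
  by-upSize = On.decTotalOrder ≤-decTotalOrder upSize

  two-colouring : ∀ {S} → U.Decidable S → Width≤2 S → ∃ (ChainColouring S)
  two-colouring {S} S? width =
    Product.map₂ (chains-⊆ listed)
                 (colour-list order sorted (λ pa pb pc → width (in-S pa) (in-S pb) (in-S pc)))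
    where
    open Sort by-upSize using (sort; sort-↭; sort-↗)

    order : List (Fin m)
    order = filter S? (sort (allFin m))

    sorted : AllPairs NotStrictlyBelow order
    sorted = filter⁺ S? (AllPairs.map upSize-≤⇒not-strictly-below
               (Sorted⇒AllPairs (DecTotalOrder.totalOrder by-upSize) (sort-↗ (allFin m))))

    in-S : ∀ {a} → a ∈ₗ order → S a
    in-S = proj₂ ∘ ∈-filter⁻ S? {xs = sort (allFin m)}

    listed : ∀ {a} → S a → a ∈ₗ order
    listed sa = ∈-filter⁺ S? (∈-resp-↭ (↭-sym (sort-↭ (allFin m))) (∈-allFin _)) sa

module LexicographicRealizer {n h : ℕ} {_≼_ : Rel₀ (Fin n)} (≼? : Decidable _≼_)
    (≼-refl : Reflexive _≼_) (≼-trans : Transitive _≼_) (part : Fin n → Fin h)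
    (transfer : ∀ {u v u′ v′} → part u ≢ part v → part u′ ≡ part u → part v′ ≡ part v →
                u ≼ v → u′ ≼ v′) where

  open Incomparability ≼? ≼-refl ≼-trans using (_∥_; ∥?; ∥-sym; compare)

  SeparatesModules : (Fin h → Bool) → Set
  SeparatesModules outer = ∀ {u v} → u ∥ v → part u ≢ part v → outer (part u) ≢ outer (part v)

  SeparatesWithinModules : (Fin n → Bool) → Set
  SeparatesWithinModules inner = ∀ {u v} → u ∥ v → part u ≡ part v → inner u ≢ inner v

  infix 4 _<ₖ_
  _<ₖ_ : Rel₀ (Bool × Bool)
  _<ₖ_ = ×-Lex _≡_ _<ᵇ_ _<ᵇ_

  <ₖ-trans : Transitive _<ₖ_
  <ₖ-trans = ×-transitive {_≈₁_ = _≡_} {_<₁_ = _<ᵇ_} {_<₂_ = _<ᵇ_}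
               isEquivalence (resp₂ _<ᵇ_) <-trans <-trans

  <ₖ-asym : Asymmetric _<ₖ_
  <ₖ-asym = ×-asymmetric {_≈₁_ = _≡_} {_<₁_ = _<ᵇ_} {_<₂_ = _<ᵇ_}
              sym (resp₂ _<ᵇ_) <-asym <-asym

  <ₖ-cmp : Trichotomous (Pointwise _≡_ _≡_) _<ₖ_
  <ₖ-cmp = ×-compare sym <-cmp <-cmp

  <ₖ? : Decidable _<ₖ_
  <ₖ? = ×-decidable Bool._≟_ _<?_ _<?_

  not-reverses-< : ∀ {a a′} → not a <ᵇ not a′ → a′ <ᵇ a
  not-reverses-< {true} {false} f<t = f<t

  not-reverses-<ₖ : ∀ {a b a′ b′} → (not a , not b) <ₖ (not a′ , not b′) → (a′ , b′) <ₖ (a , b)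
  not-reverses-<ₖ (inj₁ a<a′)           = inj₁ (not-reverses-< a<a′)
  not-reverses-<ₖ (inj₂ (a≡a′ , b<b′)) = inj₂ (sym (not-injective a≡a′) , not-reverses-< b<b′)

  ≢-top⇒< : ∀ {x y z} → x ≢ z → y <ᵇ z → x <ᵇ z
  ≢-top⇒< {false} x≢z f<t = f<t
  ≢-top⇒< {true}  x≢z f<t = contradiction refl x≢z

  module LinearExtension {outer : Fin h → Bool} {inner : Fin n → Bool}
                         (outer-sep : SeparatesModules outer)
                         (inner-sep : SeparatesWithinModules inner) where

    key : Fin n → Bool × Bool
    key u = outer (part u) , inner u

    Before : Rel₀ (Fin n)
    Before u v = u ∥ v × key u <ₖ key v

    infix 4 _⊑_
    _⊑_ : Rel₀ (Fin n)
    u ⊑ v = u ≼ v ⊎ Before u v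

    before-across : ∀ {u v} → Before u v → part u ≢ part v → outer (part u) <ᵇ outer (part v)
    before-across (_   , inj₁ o<o′)      _     = o<o′
    before-across (u∥v , inj₂ (o≡o′ , _)) pu≢pv = contradiction o≡o′ (outer-sep u∥v pu≢pv)

    before-within : ∀ {u v} → Before u v → part u ≡ part v → inner u <ᵇ inner v
    before-within (_ , inj₁ o<o′)       pu≡pv = contradiction o<o′ (<-irrefl (cong outer pu≡pv))
    before-within (_ , inj₂ (_ , i<i′)) _     = i<i′

    distinct-keys : ∀ {u v} → u ∥ v → ¬ Pointwise _≡_ _≡_ (key u) (key v)
    distinct-keys {u} {v} u∥v (o≡o′ , i≡i′) with part u ≟ part v
    ... | yes pu≡pv = inner-sep u∥v pu≡pv i≡i′
    ... | no pu≢pv  = outer-sep u∥v pu≢pv o≡o′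

    before-or-after : ∀ {u v} → u ∥ v → Before u v ⊎ Before v u
    before-or-after {u} {v} u∥v with <ₖ-cmp (key u) (key v)
    ... | tri< u<v _   _   = inj₁ (u∥v , u<v)
    ... | tri≈ _   u≋v _   = contradiction u≋v (distinct-keys u∥v)
    ... | tri> _   _   v<u = inj₂ (∥-sym u∥v , v<u)

    before⇒⋣ : ∀ {u v} → Before u v → ¬ v ⊑ u
    before⇒⋣ (u∥v , _)   (inj₁ v≼u)       = proj₂ u∥v v≼u
    before⇒⋣ (_   , u<v) (inj₂ (_ , v<u)) = <ₖ-asym u<v v<u

    ≼-before : ∀ {u v w} → u ≼ v → Before v w → u ⊑ w
    ≼-before {u} {v} {w} u≼v v<w@(v∥w , _) with compare u w
    ... | inj₁ u≼w        = inj₁ u≼w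
    ... | inj₂ (inj₁ w≼u) = contradiction (≼-trans w≼u u≼v) (proj₂ v∥w)
    ... | inj₂ (inj₂ u∥w) = inj₂ (u∥w , key-order (part u ≟ part w) (part v ≟ part w))
      where
      key-order : Dec (part u ≡ part w) → Dec (part v ≡ part w) → key u <ₖ key w
      key-order (yes pu≡pw) (yes pv≡pw) =
        inj₂ (cong outer pu≡pw , ≢-top⇒< (inner-sep u∥w pu≡pw) (before-within v<w pv≡pw))
      key-order (no pu≢pw) (no pv≢pw) =
        inj₁ (≢-top⇒< (outer-sep u∥w pu≢pw) (before-across v<w pv≢pw))
      key-order (yes pu≡pw) (no pv≢pw) =
        contradiction (transfer (λ pu≡pv → pv≢pw (trans (sym pu≡pv) pu≡pw)) (sym pu≡pw) refl u≼v)
                      (proj₂ v∥w)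
      key-order (no pu≢pw) (yes pv≡pw) =
        contradiction (transfer (λ pu≡pv → pu≢pw (trans pu≡pv pv≡pw)) refl (sym pv≡pw) u≼v)
                      (proj₁ u∥w)

    before-≼ : ∀ {u v w} → Before u v → v ≼ w → u ⊑ w
    before-≼ {u} {v} {w} u<v v≼w with compare u w
    ... | inj₁ u≼w        = inj₁ u≼w
    ... | inj₂ (inj₁ w≼u) = contradiction (inj₁ (≼-trans v≼w w≼u)) (before⇒⋣ u<v)
    ... | inj₂ (inj₂ u∥w) with before-or-after u∥w
    ...   | inj₁ u<w = inj₂ u<w
    ...   | inj₂ w<u = contradiction (≼-before v≼w w<u) (before⇒⋣ u<v)

    before-before : ∀ {u v w} → Before u v → Before v w → u ⊑ w
    before-before {u} {v} {w} u<v v<w with compare u w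
    ... | inj₁ u≼w        = inj₁ u≼w
    ... | inj₂ (inj₁ w≼u) = contradiction (≼-before w≼u u<v) (before⇒⋣ v<w)
    ... | inj₂ (inj₂ u∥w) = inj₂ (u∥w , <ₖ-trans (proj₂ u<v) (proj₂ v<w))

    ⊑? : Decidable _⊑_
    ⊑? u v = ≼? u v ⊎-dec (∥? u v ×-dec <ₖ? (key u) (key v))

    ⊑-refl : Reflexive _⊑_
    ⊑-refl = inj₁ ≼-refl

    ⊑-trans : Transitive _⊑_
    ⊑-trans (inj₁ u≼v) (inj₁ v≼w) = inj₁ (≼-trans u≼v v≼w)
    ⊑-trans (inj₁ u≼v) (inj₂ v<w) = ≼-before u≼v v<w
    ⊑-trans (inj₂ u<v) (inj₁ v≼w) = before-≼ u<v v≼w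
    ⊑-trans (inj₂ u<v) (inj₂ v<w) = before-before u<v v<w

    ⊑-total : Total _⊑_
    ⊑-total u v with compare u v
    ... | inj₁ u≼v        = inj₁ (inj₁ u≼v)
    ... | inj₂ (inj₁ v≼u) = inj₂ (inj₁ v≼u)
    ... | inj₂ (inj₂ u∥v) = Sum.map inj₂ inj₂ (before-or-after u∥v)

    open Rank ⊑? ⊑-refl ⊑-trans ⊑-total public using (rank; rank-mono; rank-reflects)

  -- Negating both colourings reverses the key order, so the two extensions disagree on every u ∥ v.
  dominance-drawing : ∃ SeparatesModules → ∃ SeparatesWithinModules →
    Σ (Fin n → ℕ) λ X → Σ (Fin n → ℕ) λ Y →
      ∀ u v → (u ≼ v → X u ≤ X v × Y u ≤ Y v) × (X u ≤ X v × Y u ≤ Y v → u ≼ v)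
  dominance-drawing (outer , outer-sep) (inner , inner-sep) =
    L.rank , R.rank , λ u v → (λ u≼v → L.rank-mono (inj₁ u≼v) , R.rank-mono (inj₁ u≼v))
                             , λ (X≤ , Y≤) → realized (L.rank-reflects X≤) (R.rank-reflects Y≤)
    where
    module L = LinearExtension {outer} {inner} outer-sep inner-sep
    module R = LinearExtension {not ∘ outer} {not ∘ inner}
                 (λ u∥v pu≢pv → outer-sep u∥v pu≢pv ∘ not-injective)
                 (λ u∥v pu≡pv → inner-sep u∥v pu≡pv ∘ not-injective)

    realized : ∀ {u v} → u L.⊑ v → u R.⊑ v → u ≼ v
    realized (inj₁ u≼v)      _                = u≼v
    realized (inj₂ _)        (inj₁ u≼v)       = u≼v
    realized (inj₂ (_ , u<v)) (inj₂ (_ , u<′v)) = ⊥-elim (<ₖ-asym u<v (not-reverses-<ₖ u<′v))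

module _ {V : Set} {_⟶_ : Rel₀ V} where

  star⇒≡⊎plus : ∀ {x y} → Star _⟶_ x y → x ≡ y ⊎ TransClosure _⟶_ x y
  star⇒≡⊎plus ε = inj₁ refl
  star⇒≡⊎plus (x⟶z ◅ z↝y) with star⇒≡⊎plus z↝y
  ... | inj₁ refl = inj₂ [ x⟶z ]
  ... | inj₂ z↝⁺y = inj₂ (x⟶z ∷ z↝⁺y)

  plus⇒star : ∀ {x y} → TransClosure _⟶_ x y → Star _⟶_ x y
  plus⇒star [ x⟶y ]      = x⟶y ◅ ε
  plus⇒star (x⟶z ∷ z↝⁺y) = x⟶z ◅ plus⇒star z↝⁺y

  no-three-incomparable : ∀ {w a b c} → HasWidth _⟶_ w → w ≤ 2 →
    Incomparable _⟶_ a b → Incomparable _⟶_ a c → Incomparable _⟶_ b c → ⊥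
  no-three-incomparable {a = a} {b} {c} (_ , bounded) w≤2 a∥b a∥c b∥c
    with ≤-trans (bounded (a ∷ b ∷ c ∷ []) ((a∥b ∷ a∥c ∷ []) ∷ (b∥c ∷ []) ∷ [] ∷ [])) w≤2
  ... | s≤s (s≤s ())

module CongruencePartition {n h : ℕ} (A : Adj n) (part : Fin n → Fin h)
                           (cp : IsCongruencePartition A part) where

  infix 4 _↝_
  _↝_ : Rel₀ (Fin n)
  _↝_ = Reach (Edge A)

  ↝? : Decidable _↝_
  ↝? = Reachability.Star? (λ u v → T? (A u v))

  module-pred : ∀ {i x y w} → part x ≡ i → part y ≡ i → part w ≢ i →
                ReachPlus (Edge A) w x → ReachPlus (Edge A) w y
  module-pred {i} {x} {y} {w} px py pw = proj₁ (proj₁ (proj₂ (cp i) x y w px py pw))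

  module-succ : ∀ {i x y w} → part x ≡ i → part y ≡ i → part w ≢ i →
                ReachPlus (Edge A) x w → ReachPlus (Edge A) y w
  module-succ {i} {x} {y} {w} px py pw = proj₁ (proj₂ (proj₂ (cp i) x y w px py pw))

  transfer : ∀ {u v u′ v′} → part u ≢ part v → part u′ ≡ part u → part v′ ≡ part v → u ↝ v → u′ ↝ v′
  transfer pu≢pv pu′ pv′ u↝v with star⇒≡⊎plus u↝v
  ... | inj₁ refl = contradiction refl pu≢pv
  ... | inj₂ u↝⁺v = plus⇒star (module-pred refl pv′ (λ pu′≡pv → pu≢pv (trans (sym pu′) pu′≡pv))
                                 (module-succ refl pu′ (pu≢pv ∘ sym) u↝⁺v))

  quotient-reach : ∀ {i j} → Star (QuotientEdge A part) i j →
                   i ≡ j ⊎ (∀ {u v} → part u ≡ i → part v ≡ j → u ↝ v)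
  quotient-reach ε = inj₁ refl
  quotient-reach ((a , b , a⟶b , refl , refl) ◅ rest) with part a ≟ part b | quotient-reach rest
  ... | yes pa≡pb | reach rewrite pa≡pb = reach
  ... | no pa≢pb  | inj₁ refl  = inj₂ λ pu pv → transfer pa≢pb pu pv (a⟶b ◅ ε)
  ... | no pa≢pb  | inj₂ reach = inj₂ λ pu pv → transfer pa≢pb pu refl (a⟶b ◅ ε) ◅◅ reach refl pv

  sink-final : ∀ {i z b} → ¬ Star (GiEdge A part i) (inj₂ (inj₂ z)) (inj₁ b)
  sink-final (_◅_ {j = inj₁ _}        () _)
  sink-final (_◅_ {j = inj₂ (inj₁ _)} () _)
  sink-final (_◅_ {j = inj₂ (inj₂ _)} () _)

  module-path : ∀ {i a b} → Star (GiEdge A part i) (inj₁ a) (inj₁ b) → proj₁ a ↝ proj₁ b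
  module-path ε                                   = ε
  module-path (_◅_ {j = inj₁ _}        a⟶c c↝b)   = a⟶c ◅ module-path c↝b
  module-path (_◅_ {j = inj₂ (inj₁ _)} () _)
  module-path (_◅_ {j = inj₂ (inj₂ _)} _ sink↝b) = ⊥-elim (sink-final sink↝b)

  rep : Fin h → Fin n
  rep i = proj₁ (proj₁ (cp i))

  rep-part : ∀ i → part (rep i) ≡ i
  rep-part i = proj₂ (proj₁ (cp i))

  infix 4 _≼₀_
  _≼₀_ : Rel₀ (Fin h)
  i ≼₀ j = rep i ↝ rep j

  quotient⇒≼₀ : ∀ {i j} → Star (QuotientEdge A part) i j → i ≼₀ j
  quotient⇒≼₀ path with quotient-reach path
  ... | inj₁ refl  = ε
  ... | inj₂ reach = reach (rep-part _) (rep-part _)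

  ≼₀⇒↝ : ∀ {u v} → part u ≢ part v → part u ≼₀ part v → u ↝ v
  ≼₀⇒↝ pu≢pv = transfer (λ e → pu≢pv (trans (sym (rep-part _)) (trans e (rep-part _))))
                        (sym (rep-part _)) (sym (rep-part _))

  module Q = Incomparability (λ i j → ↝? (rep i) (rep j)) ε _◅◅_
  module G = Incomparability ↝? ε _◅◅_
  open LexicographicRealizer ↝? ε _◅◅_ part transfer public
    using (SeparatesModules; SeparatesWithinModules; dominance-drawing)

  outer-colouring : ∀ {w₀} → HasWidth (QuotientEdge A part) w₀ → w₀ ≤ 2 → ∃ SeparatesModules
  outer-colouring width w₀≤2 = Product.map₂ separates (Q.two-colouring (λ _ → yes tt) narrow)
    where
    incomparable : ∀ {i j} → i Q.∥ j → Incomparable (QuotientEdge A part) i j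
    incomparable (i⋠j , j⋠i) = i⋠j ∘ quotient⇒≼₀ , j⋠i ∘ quotient⇒≼₀

    narrow : Q.Width≤2 (λ _ → ⊤)
    narrow _ _ _ i∥j i∥k j∥k =
      no-three-incomparable width w₀≤2 (incomparable i∥j) (incomparable i∥k) (incomparable j∥k)

    separates : ∀ {outer} → Q.ChainColouring (λ _ → ⊤) outer → SeparatesModules outer
    separates chains (u⋠v , v⋠u) pu≢pv =
      chains tt tt (u⋠v ∘ ≼₀⇒↝ pu≢pv , v⋠u ∘ ≼₀⇒↝ (pu≢pv ∘ sym))

  inner-colouring : ∀ {w : Fin h → ℕ} → (∀ i → HasWidth (GiEdge A part i) (w i)) → (∀ i → w i ≤ 2) →
                    ∃ SeparatesWithinModules
  inner-colouring widths w≤2 = inner , separates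
    where
    incomparable : ∀ {i a b} (pa : part a ≡ i) (pb : part b ≡ i) → a G.∥ b →
                   Incomparable (GiEdge A part i) (inj₁ (a , pa)) (inj₁ (b , pb))
    incomparable _ _ (a⋠b , b⋠a) = a⋠b ∘ module-path , b⋠a ∘ module-path

    narrow : ∀ i → G.Width≤2 (λ v → part v ≡ i)
    narrow i pa pb pc a∥b a∥c b∥c = no-three-incomparable (widths i) (w≤2 i)
      (incomparable pa pb a∥b) (incomparable pa pc a∥c) (incomparable pb pc b∥c)

    colouring : ∀ i → ∃ (G.ChainColouring (λ v → part v ≡ i))
    colouring i = G.two-colouring (λ v → part v ≟ i) (narrow i)

    inner : Fin n → Bool
    inner v = proj₁ (colouring (part v)) v

    separates : SeparatesWithinModules inner
    separates {u} {v} u∥v pu≡pv same = proj₂ (colouring (part u)) refl (sym pu≡pv) u∥v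
      (trans same (cong (λ i → proj₁ (colouring i) v) (sym pu≡pv)))

corollary5 : (n h : ℕ) (A : Adj n) (part : Fin n → Fin h) →
    IsSTGraph (Edge A) →
    IsCongruencePartition A part →
    DimensionalNeck A part 2 →
    Σ (Fin n → ℕ) λ X → Σ (Fin n → ℕ) λ Y → IsDominanceDrawing2 A X Y
corollary5 n h A part _ cp (_ , _ , width₀ , widths , (w₀≤2 , w≤2) , _) =
  dominance-drawing (outer-colouring width₀ w₀≤2) (inner-colouring widths w≤2)
  where open CongruencePartition A part cp
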